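{- Let $d \ge 3$ be an integer and let $\ell \ge 5$ be a prime. Let $x,y$ be integers satisfying \[ d(2x+d+1)\left(x^2+(d+1)x+\frac{d(d+1)}{2}\right)=2y^\ell . \] Then there exist rational numbers $y_1, y_2$ and a pair $(\alpha,\beta)\in\mathcal{A}_d$ such that \[ 2x+d+1=\alpha y_1^\ell, \qquad x^2+(d+1)x+\frac{d(d+1)}{2}=\beta y_2^\ell . \] Moreover, if $3 \le d \le 50$ then $y_1$ and $y_2$ are integers.
   Context: For a prime $q$ let $\mu_q=\mathrm{ord}_q(d^2-1)$ and $\nu_q=\mathrm{ord}_q(d)$. Associate to each prime $q$ a finite set $T_q\subset\mathbb{Z}^2$: if $q\nmid d(d^2-1)$, $T_q=\{(0,0)\}$. For $q=2$: if $2\mid d$, $T_2=\{(0,1-\nu_2)\}$; if $2\nmid d$ and $\mu_2$ is even, $T_2=\{(1,0),(\mu_2/2,1-\mu_2/2),(3-\mu_2,\mu_2-2)\}$; if $2\nmid d$ and $\mu_2$ is odd, $T_2=\{(1,0),(3-\mu_2,\mu_2-2)\}$. For odd $q\mid d$: $T_q=\{(-\nu_q,0),(0,-\nu_q)\}$. For odd $q\mid d^2-1$: if $\mu_q$ is even, $T_q=\{(0,0),(-\mu_q,\mu_q),(\mu_q/2,-\mu_q/2)\}$; if $\mu_q$ is odd, $T_q=\{(0,0),(-\mu_q,\mu_q)\}$. Then $\mathcal{A}_d$ is the (finite) set of pairs of positive rationals $(\alpha,\beta)$ with $(\mathrm{ord}_q(\alpha),\mathrm{ord}_q(\beta))\in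 T_q$ for every prime $q$. -}

module Defs where

open import Data.Nat as ℕ using (ℕ; zero; suc; _∸_; _%_; _/_)
open import Data.Nat.Divisibility using (_∣?_)
open import Data.Integer as ℤ using (ℤ; +_; -_)
open import Data.Rational as ℚ using (ℚ; ↥_; ↧ₙ_; Positive; 0ℚ; 1ℚ)
open import Data.Product using (_×_; _,_)
open import Data.List using (List; []; _∷_)
open import Data.List.Membership.Propositional using (_∈_)
open import Data.Nat.Primality using (Prime)
open import Relation.Nullary using (yes; no; Dec)
open import Relation.Binary.PropositionalEquality using (_≡_)

-- q-adic valuation of a natural number: largest k with q^k ∣ n
-- (for q ≥ 2 and n > 0; the fuel n is always sufficient since q^k ≤ n).
-- Conventions for the degenerate inputs q ≤ 1 or n = 0 (value 0) are never used.
ordFuel : ℕ → (q : ℕ) → .{{_ : ℕ.NonZero q}} → ℕ → ℕ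
ordFuel zero q n = 0
ordFuel (suc f) q zero = 0
ordFuel (suc f) q n@(suc _) with q ∣? n
... | yes _ = suc (ordFuel f q (n / q))
... | no  _ = 0

ordℕ : ℕ → ℕ → ℕ
ordℕ zero n = 0
ordℕ (suc zero) n = 0
ordℕ q@(suc (suc _)) n = ordFuel n q n

ordℚ : ℕ → ℚ → ℤ
ordℚ q r = + ordℕ q ℤ.∣ ↥ r ∣ ℤ.- + ordℕ q (↧ₙ r)

_^ℚ_ : ℚ → ℕ → ℚ
r ^ℚ zero = 1ℚ
r ^ℚ suc n = r ℚ.* (r ^ℚ n)

ι : ℤ → ℚ
ι z = z ℚ./ 1

μ : ℕ → ℕ → ℤ
μ d q = + ordℕ q (d ℕ.* d ∸ 1)

ν : ℕ → ℕ → ℤ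
ν d q = + ordℕ q d

-- μ_q / 2 (only used when μ_q is even)
μhalf : ℕ → ℕ → ℤ
μhalf d q = + (ordℕ q (d ℕ.* d ∸ 1) / 2)

μeven? : (d q : ℕ) → Dec (ordℕ q (d ℕ.* d ∸ 1) % 2 ≡ 0)
μeven? d q = ordℕ q (d ℕ.* d ∸ 1) % 2 ℕ.≟ 0

T : ℕ → ℕ → List (ℤ × ℤ)
T d q with q ℕ.≟ 2
... | yes _ with 2 ∣? d
...   | yes _ = (+ 0 , + 1 ℤ.- ν d q) ∷ []
...   | no _ with μeven? d q
...     | yes _ = (+ 1 , + 0) ∷ (μhalf d q , + 1 ℤ.- μhalf d q)
                   ∷ (+ 3 ℤ.- μ d q , μ d q ℤ.- + 2) ∷ []
...     | no _  = (+ 1 , + 0) ∷ (+ 3 ℤ.- μ d q , μ d q ℤ.- + 2) ∷ []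
T d q | no _ with q ∣? d
...   | yes _ = (- ν d q , + 0) ∷ (+ 0 , - ν d q) ∷ []
...   | no _ with q ∣? (d ℕ.* d ∸ 1)
...     | no _ = (+ 0 , + 0) ∷ []
...     | yes _ with μeven? d q
...       | yes _ = (+ 0 , + 0) ∷ (- μ d q , μ d q) ∷ (μhalf d q , - μhalf d q) ∷ []
...       | no _  = (+ 0 , + 0) ∷ (- μ d q , μ d q) ∷ []

InA : ℕ → ℚ → ℚ → Set
InA d α β = Positive α × Positive β ×
  ((q : ℕ) → Prime q → (ordℚ q α , ordℚ q β) ∈ T d q)

-- x² + (d+1)x + d(d+1)/2  (an integer since d(d+1) is even)
Qpoly : ℕ → ℤ → ℤ
Qpoly d x = x ℤ.* x ℤ.+ + (suc d) ℤ.* x ℤ.+ + ((d ℕ.* suc d) / 2)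

Lpoly : ℕ → ℤ → ℤ
Lpoly d x = + 2 ℤ.* x ℤ.+ + d ℤ.+ + 1

module Submission where

open import Defs
open import Data.Nat using (ℕ; _≤_)
open import Data.Nat.Primality using (Prime)
open import Data.Integer as ℤ using (ℤ; +_)
open import Data.Rational using (ℚ)
open import Data.Product using (Σ; ∃; _×_)
open import Relation.Binary.PropositionalEquality using (_≡_)

open import Data.Nat as ℕ
  using (zero; suc; _≟_; _+_; _*_; _%_; _<_; _^_; _∸_; _/_; s≤s; z≤n; 2+; NonZero; NonTrivial;
         ≢-nonZero; ≢-nonZero⁻¹; >-nonZero⁻¹; >-nonZero; nonTrivial⇒≢1; nonTrivial⇒nonZero; n>1⇒nonTrivial)
open import Data.Nat.Properties
open import Data.Nat.Divisibility
open import Data.Nat.DivMod using (m*n%n≡0; m%n<n; m≡m%n+[m/n]*n; m*n/n≡m; m/n<m; m/n*n≡m)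
open import Data.Nat.GCD using (gcd)
open import Data.Nat.ListAction using (product)
open import Data.Nat.Primality
  using (euclidsLemma; prime[2]; prime⇒nonTrivial; prime⇒nonZero; prime⇒irreducible; productOfPrimes≢0)
open import Data.Nat.Primality.Factorisation using (factorise; PrimeFactorisation)
open import Data.Nat.Tactic.RingSolver using (solve-∀)
open import Data.Integer using (sign; _◃_)
import Data.Integer.Properties as ℤP
import Data.Integer.Tactic.RingSolver as ℤSolver
import Data.Rational as ℚ
import Data.Rational.Properties as ℚP
import Data.Rational.Unnormalised as ℚᵘ
open ℚᵘ using (mkℚᵘ)
import Data.Rational.Unnormalised.Properties as ℚᵘP
import Data.Sign as Sign
open import Data.List using ([]; _∷_)
open import Data.List.Relation.Unary.All using (All; []; _∷_)
open import Data.List.Relation.Unary.Any using (here; there)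
open import Data.List.Membership.Propositional using (_∈_)
open import Data.Product using (_,_; proj₁; proj₂; ∃-syntax)
open import Data.Sum using (inj₁; inj₂; [_,_]′)
open import Data.Empty using (⊥-elim)
open import Function using (it; _∘_; id; flip)
open import Relation.Binary.Definitions using (tri<; tri≈; tri>)
open import Relation.Nullary using (¬_; Dec; yes; no; contradiction)
open import Relation.Binary.PropositionalEquality using (_≢_; refl; sym; trans; cong; cong₂; subst; module ≡-Reasoning)

-- With n = |2x+d+1|, Q = x²+(d+1)x+d(d+1)/2 and D = d²−1 one has 4Q = n² + D and
-- d·n·Q = 2|y|^ℓ.  Fix a prime q and let t, v, a, b, m, e be the q-adic valuations of
-- 2, d, n, Q, D, |y|.  Then v + a + b = t + ℓe, and by the strict ultrametric inequality
-- 2t + b is 2a if 2a < m and m if 2a > m.  In each of the three cases 2a <, =, > m some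
-- f ≤ e makes (a − ℓf, b − ℓ(e − f)) an element of T_q; for 2a < m this uses 3(a − t) = ℓe
-- and ℓ ∤ 3.  Integers y₁, y₂ with ord_q y₁ = f and ord_q y₂ = e − f at every q then give
-- α = n/y₁^ℓ and β = Q/y₂^ℓ in 𝒜_d, so y₁, y₂ are integral for every d, not only d ≤ 50.
-- If 2x+d+1 = 0 then 4Q = D, and y₁ = 0, y₂ = 1, α = 8/(dD), β = Q work.

-- q-adic valuations of natural numbers

private
  ∤⇒≢0 : ∀ {d n} → ¬ d ∣ n → NonZero n
  ∤⇒≢0 {n = zero} d∤0 = contradiction (_ ∣0) d∤0
  ∤⇒≢0 {n = suc n} _ = _

  ordFuel-∤ : ∀ f {q} .{{_ : NonZero q}} {n} → ¬ q ∣ n → ordFuel f q n ≡ 0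
  ordFuel-∤ zero q∤n = refl
  ordFuel-∤ (suc f) {q} {zero} q∤n = refl
  ordFuel-∤ (suc f) {q} {suc n} q∤n with q ∣? suc n
  ... | yes q∣n = contradiction q∣n q∤n
  ... | no _ = refl

  ordFuel-∣ : ∀ f {q} .{{_ : NonZero q}} {n} .{{_ : NonZero n}} → q ∣ n →
              ordFuel (suc f) q n ≡ suc (ordFuel f q (n / q))
  ordFuel-∣ f {q} {suc n} q∣n with q ∣? suc n
  ... | yes _ = refl
  ... | no q∤n = contradiction q∣n q∤n

  ordFuel-q^a* : ∀ {k} a f {m} → ¬ 2+ k ∣ m → 2+ k ^ a * m ≤ f →
                 ordFuel f (2+ k) (2+ k ^ a * m) ≡ a
  ordFuel-q^a* zero f {m} q∤m _ = subst (λ n → ordFuel f _ n ≡ 0) (sym (*-identityˡ m)) (ordFuel-∤ f q∤m)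
  ordFuel-q^a* {k} (suc a) (suc f) {m} q∤m q^a*m≤f = begin
    ordFuel (suc f) q (q ^ suc a * m)  ≡⟨ cong (ordFuel (suc f) q) (*-assoc q (q ^ a) m) ⟩
    ordFuel (suc f) q (q * N)          ≡⟨ ordFuel-∣ f (m∣m*n N) ⟩
    suc (ordFuel f q (q * N / q))      ≡⟨ cong (λ n → suc (ordFuel f q n)) qN/q≡N ⟩
    suc (ordFuel f q N)                ≡⟨ cong suc (ordFuel-q^a* a f q∤m N≤f) ⟩
    suc a                              ∎
    where
    open ≡-Reasoning
    q = 2+ k
    N = q ^ a * m
    instance
      N≢0 : NonZero N
      N≢0 = m*n≢0 (q ^ a) m {{m^n≢0 q a}} {{∤⇒≢0 q∤m}}
      qN≢0 : NonZero (q * N)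
      qN≢0 = m*n≢0 q N
    qN/q≡N : q * N / q ≡ N
    qN/q≡N = trans (cong (_/ q) (*-comm q N)) (m*n/n≡m N q)
    N≤f : N ≤ f
    N≤f = ℕ.≤-pred (≤-trans (m<m*n N q (s≤s (s≤s z≤n))) (≤-trans (≤-reflexive (*-comm N q))
            (≤-trans (≤-reflexive (sym (*-assoc q (q ^ a) m))) q^a*m≤f)))
  ordFuel-q^a* {k} (suc a) zero {m} q∤m q^a*m≤0 = ⊥-elim (≢-nonZero⁻¹ _ {{n≢0}} (n≤0⇒n≡0 q^a*m≤0))
    where
    instance _ = ∤⇒≢0 q∤m
    n≢0 = m*n≢0 (2+ k ^ suc a) m {{m^n≢0 (2+ k) (suc a)}}

  ordFuel-factor : ∀ {k} f n .{{_ : NonZero n}} → n ≤ f →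
                   ∃[ m ] ¬ 2+ k ∣ m × n ≡ 2+ k ^ ordFuel f (2+ k) n * m
  ordFuel-factor {k} f n n≤f with 2+ k ∣? n
  ordFuel-factor {k} f n n≤f | no q∤n =
    n , q∤n , trans (sym (*-identityˡ n)) (cong (λ o → 2+ k ^ o * n) (sym (ordFuel-∤ f q∤n)))
  ordFuel-factor {k} zero n n≤0 | yes _ = ⊥-elim (≢-nonZero⁻¹ n (n≤0⇒n≡0 n≤0))
  ordFuel-factor {k} (suc f) n n≤f | yes q∣n@(divides c n≡c*q) =
    m , q∤m , (begin
      n                           ≡⟨ n≡c*q ⟩
      c * q                       ≡⟨ cong (_* q) c≡q^o*m ⟩
      q ^ o * m * q               ≡⟨ *-comm (q ^ o * m) q ⟩
      q * (q ^ o * m)             ≡⟨ *-assoc q (q ^ o) m ⟨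
      q ^ suc o * m               ≡⟨ cong (λ o → q ^ o * m) ordFuel≡suc-o ⟨
      q ^ ordFuel (suc f) q n * m ∎)
    where
    open ≡-Reasoning
    q = 2+ k
    n/q≡c : n / q ≡ c
    n/q≡c = trans (cong (_/ q) n≡c*q) (m*n/n≡m c q)
    ordFuel≡suc-o : ordFuel (suc f) q n ≡ suc (ordFuel f q c)
    ordFuel≡suc-o = trans (ordFuel-∣ f q∣n) (cong (λ n → suc (ordFuel f q n)) n/q≡c)
    instance
      c≢0 : NonZero c
      c≢0 = m*n≢0⇒m≢0 c {q} {{subst NonZero n≡c*q it}}
    c≤f : c ≤ f
    c≤f = ℕ.≤-pred (≤-trans (subst (_< n) n/q≡c (m/n<m n q (s≤s (s≤s z≤n)))) n≤f)
    o = ordFuel f q c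
    IH = ordFuel-factor f c c≤f
    m = proj₁ IH
    q∤m = proj₁ (proj₂ IH)
    c≡q^o*m = proj₂ (proj₂ IH)

ordℕ-q^a* : ∀ {q} .{{_ : NonTrivial q}} a {m} → ¬ q ∣ m → ordℕ q (q ^ a * m) ≡ a
ordℕ-q^a* {2+ k} a q∤m = ordFuel-q^a* a _ q∤m ≤-refl

ordℕ-factor : ∀ {q} .{{_ : NonTrivial q}} n .{{_ : NonZero n}} → ∃[ m ] ¬ q ∣ m × n ≡ q ^ ordℕ q n * m
ordℕ-factor {2+ k} n = ordFuel-factor n n ≤-refl

ordℕ-∤ : ∀ {q} .{{_ : NonTrivial q}} {n} → ¬ q ∣ n → ordℕ q n ≡ 0
ordℕ-∤ {q} {n} q∤n = subst (λ m → ordℕ q m ≡ 0) (*-identityˡ n) (ordℕ-q^a* 0 q∤n)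

ordℕ≢0⇒∣ : ∀ {q} .{{_ : NonTrivial q}} {n} → ordℕ q n ≢ 0 → q ∣ n
ordℕ≢0⇒∣ {q} {n} o≢0 with q ∣? n
... | yes q∣n = q∣n
... | no q∤n = contradiction (ordℕ-∤ q∤n) o≢0

ordℕ-1 : ∀ {q} .{{_ : NonTrivial q}} → ordℕ q 1 ≡ 0
ordℕ-1 = ordℕ-∤ (nonTrivial⇒≢1 ∘ ∣1⇒≡1)

ordℕ-self : ∀ {q} .{{_ : NonTrivial q}} → ordℕ q q ≡ 1
ordℕ-self {q} = subst (λ n → ordℕ q n ≡ 1) (trans (*-identityʳ (q * 1)) (*-identityʳ q))
                  (ordℕ-q^a* 1 (nonTrivial⇒≢1 ∘ ∣1⇒≡1))

ordℕ-prime : ∀ {q p} .{{_ : NonTrivial q}} → Prime p → q ≢ p → ordℕ q p ≡ 0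
ordℕ-prime p-prime q≢p = ordℕ-∤ λ q∣p → [ nonTrivial⇒≢1 , q≢p ]′ (prime⇒irreducible p-prime q∣p)

ordℕ-* : ∀ {q} → Prime q → ∀ m n .{{_ : NonZero m}} .{{_ : NonZero n}} →
         ordℕ q (m * n) ≡ ordℕ q m + ordℕ q n
ordℕ-* {q} q-prime m n = begin
  ordℕ q (m * n)                         ≡⟨ cong (ordℕ q) m*n≡ ⟩
  ordℕ q (q ^ (a + b) * (m′ * n′))       ≡⟨ ordℕ-q^a* (a + b) q∤m′n′ ⟩
  a + b                                  ∎
  where
  open ≡-Reasoning
  instance _ = prime⇒nonTrivial q-prime
  a = ordℕ q m
  b = ordℕ q n
  fm = ordℕ-factor m
  fn = ordℕ-factor n
  m′ = proj₁ fm
  n′ = proj₁ fn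
  q∤m′n′ : ¬ q ∣ m′ * n′
  q∤m′n′ q∣m′n′ = [ proj₁ (proj₂ fm) , proj₁ (proj₂ fn) ]′ (euclidsLemma m′ n′ q-prime q∣m′n′)
  m*n≡ : m * n ≡ q ^ (a + b) * (m′ * n′)
  m*n≡ = begin
    m * n                          ≡⟨ cong₂ _*_ (proj₂ (proj₂ fm)) (proj₂ (proj₂ fn)) ⟩
    q ^ a * m′ * (q ^ b * n′)      ≡⟨ interchange (q ^ a) m′ (q ^ b) n′ ⟩
    q ^ a * q ^ b * (m′ * n′)      ≡⟨ cong (_* (m′ * n′)) (^-distribˡ-+-* q a b) ⟨
    q ^ (a + b) * (m′ * n′)        ∎
    where
    interchange : ∀ w x y z → w * x * (y * z) ≡ w * y * (x * z)
    interchange = solve-∀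

ordℕ-^ : ∀ {q} → Prime q → ∀ m .{{_ : NonZero m}} k → ordℕ q (m ^ k) ≡ k * ordℕ q m
ordℕ-^ q-prime m zero = ordℕ-1 {{prime⇒nonTrivial q-prime}}
ordℕ-^ {q} q-prime m (suc k) =
  trans (ordℕ-* q-prime m (m ^ k)) (cong (_+_ (ordℕ q m)) (ordℕ-^ q-prime m k))
  where instance _ = m^n≢0 m k

ordℕ-+ : ∀ {q} .{{_ : NonTrivial q}} m n .{{_ : NonZero m}} .{{_ : NonZero n}} →
         ordℕ q m < ordℕ q n → ordℕ q (m + n) ≡ ordℕ q m
ordℕ-+ {q} m n a<b = trans (cong (ordℕ q) m+n≡) (ordℕ-q^a* a q∤s)
  where
  open ≡-Reasoning
  a = ordℕ q m
  b = ordℕ q n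
  c = b ∸ suc a
  fm = ordℕ-factor m
  fn = ordℕ-factor n
  m′ = proj₁ fm
  n′ = proj₁ fn
  s = m′ + q ^ suc c * n′
  a+1+c≡b : a + suc c ≡ b
  a+1+c≡b = trans (+-suc a c) (m+[n∸m]≡n a<b)
  q∤s : ¬ q ∣ s
  q∤s q∣s = proj₁ (proj₂ fm)
              (∣m+n∣m⇒∣n (subst (q ∣_) (+-comm m′ _) q∣s) (∣-trans (m∣m*n (q ^ c)) (m∣m*n n′)))
  m+n≡ : m + n ≡ q ^ a * s
  m+n≡ = begin
    m + n                                  ≡⟨ cong₂ _+_ (proj₂ (proj₂ fm)) (proj₂ (proj₂ fn)) ⟩
    q ^ a * m′ + q ^ b * n′                ≡⟨ cong (λ e → q ^ a * m′ + q ^ e * n′) a+1+c≡b ⟨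
    q ^ a * m′ + q ^ (a + suc c) * n′      ≡⟨ cong (λ x → q ^ a * m′ + x * n′) (^-distribˡ-+-* q a (suc c)) ⟩
    q ^ a * m′ + q ^ a * q ^ suc c * n′    ≡⟨ cong (_+_ (q ^ a * m′)) (*-assoc (q ^ a) (q ^ suc c) n′) ⟩
    q ^ a * m′ + q ^ a * (q ^ suc c * n′)  ≡⟨ *-distribˡ-+ (q ^ a) m′ _ ⟨
    q ^ a * s                              ∎

private
  ∃-ordℕ≡-product : ∀ {ps} → All Prime ps → (g : ℕ → ℕ) →
                    (∀ {q} → Prime q → g q ≤ ordℕ q (product ps)) →
                    ∃[ U ] NonZero U × (∀ {q} → Prime q → ordℕ q U ≡ g q)
  ∃-ordℕ≡-product [] g g≤ = 1 , _ , λ {q} q-prime → let instance _ = prime⇒nonTrivial q-prime in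
    trans ordℕ-1 (sym (n≤0⇒n≡0 (subst (g q ≤_) (ordℕ-1 {q}) (g≤ q-prime))))
  ∃-ordℕ≡-product {p ∷ ps} (p-prime ∷ ps-prime) g g≤ =
    p ^ g p * U , m*n≢0 (p ^ g p) U , ordℕ-U
    where
    instance
      p≢0 : NonZero p
      p≢0 = prime⇒nonZero p-prime
      P≢0 : NonZero (product ps)
      P≢0 = productOfPrimes≢0 ps-prime
      p^g≢0 : NonZero (p ^ g p)
      p^g≢0 = m^n≢0 p (g p)
    ordℕ-p* : ∀ {q} → Prime q → q ≢ p → ordℕ q (p * product ps) ≡ ordℕ q (product ps)
    ordℕ-p* q-prime q≢p = trans (ordℕ-* q-prime p (product ps))
                              (cong (_+ _) (ordℕ-prime {{prime⇒nonTrivial q-prime}} p-prime q≢p))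
    g′ : ℕ → ℕ
    g′ q with q ≟ p
    ... | yes _ = 0
    ... | no _ = g q
    g′≤ : ∀ {q} → Prime q → g′ q ≤ ordℕ q (product ps)
    g′≤ {q} q-prime with q ≟ p
    ... | yes _ = z≤n
    ... | no q≢p = subst (g q ≤_) (ordℕ-p* q-prime q≢p) (g≤ q-prime)
    IH = ∃-ordℕ≡-product ps-prime g′ g′≤
    U = proj₁ IH
    instance
      U≢0 : NonZero U
      U≢0 = proj₁ (proj₂ IH)
    ordℕ-U : ∀ {q} → Prime q → ordℕ q (p ^ g p * U) ≡ g q
    ordℕ-U {q} q-prime with q ≟ p | proj₂ (proj₂ IH) q-prime
    ... | yes refl | ordℕ-U≡0 = begin
      ordℕ q (q ^ g q * U)         ≡⟨ ordℕ-* q-prime (q ^ g q) U ⟩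
      ordℕ q (q ^ g q) + ordℕ q U  ≡⟨ cong₂ _+_ (ordℕ-^ q-prime q (g q)) ordℕ-U≡0 ⟩
      g q * ordℕ q q + 0           ≡⟨ trans (+-identityʳ _) (cong (g q *_) ordℕ-self) ⟩
      g q * 1                      ≡⟨ *-identityʳ (g q) ⟩
      g q                          ∎
      where open ≡-Reasoning
            instance _ = prime⇒nonTrivial q-prime
    ... | no q≢p | ordℕ-U≡g = begin
      ordℕ q (p ^ g p * U)         ≡⟨ ordℕ-* q-prime (p ^ g p) U ⟩
      ordℕ q (p ^ g p) + ordℕ q U  ≡⟨ cong₂ _+_ (ordℕ-^ q-prime p (g p)) ordℕ-U≡g ⟩
      g p * ordℕ q p + g q         ≡⟨ cong (λ o → g p * o + g q) (ordℕ-prime p-prime q≢p) ⟩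
      g p * 0 + g q                ≡⟨ cong (_+ g q) (*-zeroʳ (g p)) ⟩
      g q                          ∎
      where open ≡-Reasoning
            instance _ = prime⇒nonTrivial q-prime

∃-ordℕ≡ : ∀ Y .{{_ : NonZero Y}} (g : ℕ → ℕ) → (∀ {q} → Prime q → g q ≤ ordℕ q Y) →
          ∃[ U ] NonZero U × (∀ {q} → Prime q → ordℕ q U ≡ g q)
∃-ordℕ≡ Y g g≤ =
  ∃-ordℕ≡-product factorsPrime g (λ {q} q-prime → subst (λ n → g q ≤ ordℕ q n) isFactorisation (g≤ q-prime))
  where open PrimeFactorisation (factorise Y)

+a-+b≡+c-+d : ∀ a b c d → a + d ≡ c + b → + a ℤ.- + b ≡ + c ℤ.- + d
+a-+b≡+c-+d a b c d a+d≡c+b = begin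
  + a ℤ.- + b                      ≡⟨ shift (+ a) (+ b) (+ d) ⟩
  (+ a ℤ.+ + d) ℤ.- (+ b ℤ.+ + d)  ≡⟨ cong (ℤ._- (+ b ℤ.+ + d)) (cong +_ a+d≡c+b) ⟩
  (+ c ℤ.+ + b) ℤ.- (+ b ℤ.+ + d)  ≡⟨ cancel (+ c) (+ b) (+ d) ⟩
  + c ℤ.- + d                      ∎
  where
  open ≡-Reasoning
  shift : ∀ (a b d : ℤ) → a ℤ.- b ≡ (a ℤ.+ d) ℤ.- (b ℤ.+ d)
  shift = ℤSolver.solve-∀
  cancel : ∀ (c b d : ℤ) → (c ℤ.+ b) ℤ.- (b ℤ.+ d) ≡ c ℤ.- d
  cancel = ℤSolver.solve-∀

+a-+b≡+c : ∀ a b c → a ≡ c + b → + a ℤ.- + b ≡ + c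
+a-+b≡+c a b c a≡c+b = trans (+a-+b≡+c-+d a b c 0 (trans (+-identityʳ a) a≡c+b)) (ℤP.+-identityʳ (+ c))

pos-^ : ∀ u k → (+ u) ℤ.^ k ≡ + (u ^ k)
pos-^ u zero = refl
pos-^ u (suc k) = trans (cong (+ u ℤ.*_) (pos-^ u k)) (sym (ℤP.pos-* u (u ^ k)))

abs-^ : ∀ i k → ℤ.∣ i ℤ.^ k ∣ ≡ ℤ.∣ i ∣ ^ k
abs-^ i zero = refl
abs-^ i (suc k) = trans (ℤP.abs-* i (i ℤ.^ k)) (cong (ℤ.∣ i ∣ *_) (abs-^ i k))

i*i≡∣i∣*∣i∣ : ∀ i → i ℤ.* i ≡ + (ℤ.∣ i ∣ * ℤ.∣ i ∣)
i*i≡∣i∣*∣i∣ (+ n) = sym (ℤP.pos-* n n)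
i*i≡∣i∣*∣i∣ ℤ.-[1+ n ] = refl

-i^odd : ∀ i k → (ℤ.- i) ℤ.^ suc (k * 2) ≡ ℤ.- (i ℤ.^ suc (k * 2))
-i^odd i zero = trans (ℤP.*-identityʳ (ℤ.- i)) (cong ℤ.-_ (sym (ℤP.*-identityʳ i)))
-i^odd i (suc k) =
  trans (cong (λ z → ℤ.- i ℤ.* (ℤ.- i ℤ.* z)) (-i^odd i k)) (sign-juggle i (i ℤ.^ suc (k * 2)))
  where
  sign-juggle : ∀ i z → ℤ.- i ℤ.* (ℤ.- i ℤ.* ℤ.- z) ≡ ℤ.- (i ℤ.* (i ℤ.* z))
  sign-juggle = ℤSolver.solve-∀

¬2∣⇒≡suc[/2*2] : ∀ {ℓ} → ¬ 2 ∣ ℓ → ℓ ≡ suc (ℓ / 2 * 2)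
¬2∣⇒≡suc[/2*2] {ℓ} 2∤ℓ with ℓ % 2 | m%n<n ℓ 2 | m≡m%n+[m/n]*n ℓ 2
... | zero | _ | ℓ≡[ℓ/2]*2 = contradiction (divides (ℓ / 2) ℓ≡[ℓ/2]*2) 2∤ℓ
... | suc zero | _ | ℓ≡1+[ℓ/2]*2 = ℓ≡1+[ℓ/2]*2
... | 2+ _ | s≤s (s≤s ()) | _

private
  i*+u^odd : ∀ i u k → i ℤ.* + (u ^ suc (k * 2)) ≡ + ℤ.∣ i ∣ ℤ.* (sign i ◃ u) ℤ.^ suc (k * 2)
  i*+u^odd (+ n) u k =
    cong (+ n ℤ.*_) (sym (trans (cong (ℤ._^ suc (k * 2)) (ℤP.+◃n≡+n u)) (pos-^ u (suc (k * 2)))))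
  i*+u^odd ℤ.-[1+ n ] u k = begin
    ℤ.- + suc n ℤ.* + (u ^ ℓ)         ≡⟨ move-neg (+ suc n) (+ (u ^ ℓ)) ⟩
    + suc n ℤ.* ℤ.- + (u ^ ℓ)         ≡⟨ cong (λ z → + suc n ℤ.* ℤ.- z) (pos-^ u ℓ) ⟨
    + suc n ℤ.* ℤ.- ((+ u) ℤ.^ ℓ)     ≡⟨ cong (+ suc n ℤ.*_) (-i^odd (+ u) k) ⟨
    + suc n ℤ.* (ℤ.- + u) ℤ.^ ℓ       ≡⟨ cong (λ z → + suc n ℤ.* z ℤ.^ ℓ) (ℤP.-◃n≡-n u) ⟨
    + suc n ℤ.* (Sign.- ◃ u) ℤ.^ ℓ    ∎
    where
    open ≡-Reasoning
    ℓ = suc (k * 2)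
    move-neg : ∀ a b → ℤ.- a ℤ.* b ≡ a ℤ.* ℤ.- b
    move-neg = ℤSolver.solve-∀

i*u^ℓ≡∣i∣*[sign◃u]^ℓ : ∀ {ℓ} → ¬ 2 ∣ ℓ → ∀ i u → i ℤ.* + (u ^ ℓ) ≡ + ℤ.∣ i ∣ ℤ.* (sign i ◃ u) ℤ.^ ℓ
i*u^ℓ≡∣i∣*[sign◃u]^ℓ {ℓ} 2∤ℓ i u = subst (λ ℓ → i ℤ.* + (u ^ ℓ) ≡ + ℤ.∣ i ∣ ℤ.* (sign i ◃ u) ℤ.^ ℓ)
                                         (sym (¬2∣⇒≡suc[/2*2] 2∤ℓ)) (i*+u^odd i u (ℓ / 2))

4i≡+k⇒i≡+∣i∣ : ∀ {i k} → + 4 ℤ.* i ≡ + k → i ≡ + ℤ.∣ i ∣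
4i≡+k⇒i≡+∣i∣ {+ _} _ = refl

ordℚ-normalize : ∀ {q} → Prime q → ∀ i n .{{_ : NonZero i}} .{{_ : NonZero n}} →
                 ordℚ q (ℚ.normalize i n) ≡ + ordℕ q i ℤ.- + ordℕ q n
ordℚ-normalize {q} q-prime i n = begin
  + o N ℤ.- + o M
    ≡⟨ +a-+b≡+c-+d (o N) (o M) (o N + o g) (o M + o g) (shift (o N) (o M) (o g)) ⟩
  + (o N + o g) ℤ.- + (o M + o g)      ≡⟨ cong₂ (λ a b → + a ℤ.- + b) (ordℕ-* q-prime N g) (ordℕ-* q-prime M g) ⟨
  + o (N * g) ℤ.- + o (M * g)          ≡⟨ cong₂ (λ a b → + o a ℤ.- + o b) N*g≡i M*g≡n ⟩
  + o i ℤ.- + o n                      ∎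
  where
  open ≡-Reasoning
  o = ordℕ q
  r = ℚ.normalize i n
  N = ℤ.∣ ℚ.↥ r ∣
  M = ℚ.↧ₙ r
  g = gcd i n
  N*g≡i : N * g ≡ i
  N*g≡i = trans (sym (ℤP.abs-* (ℚ.↥ r) (+ g))) (cong ℤ.∣_∣ (ℚP.↥-normalize i n))
  M*g≡n : M * g ≡ n
  M*g≡n = ℤP.+-injective (trans (ℤP.pos-* M g) (ℚP.↧-normalize i n))
  instance
    Ng≢0 : NonZero (N * g)
    Ng≢0 = subst NonZero (sym N*g≡i) (≢-nonZero (≢-nonZero⁻¹ i))
    Mg≢0 : NonZero (M * g)
    Mg≢0 = subst NonZero (sym M*g≡n) (≢-nonZero (≢-nonZero⁻¹ n))
    N≢0 : NonZero N
    N≢0 = m*n≢0⇒m≢0 N {g}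
    M≢0 : NonZero M
    M≢0 = m*n≢0⇒m≢0 M {g}
    g≢0 : NonZero g
    g≢0 = m*n≢0⇒n≢0 N {g}
  shift : ∀ x y z → x + (y + z) ≡ x + z + y
  shift = solve-∀

toℚᵘ-ι^ℚ : ∀ s l → ℚ.toℚᵘ (ι s ^ℚ l) ℚᵘ.≃ mkℚᵘ (s ℤ.^ l) 0
toℚᵘ-ι^ℚ s zero = ℚᵘ.*≡* refl
toℚᵘ-ι^ℚ s (suc l) = ℚᵘP.≃-trans (ℚP.toℚᵘ-homo-* (ι s) (ι s ^ℚ l))
                                 (ℚᵘP.*-cong (ℚP.toℚᵘ-fromℚᵘ (mkℚᵘ s 0)) (toℚᵘ-ι^ℚ s l))

ι≡/*^ℚ : ∀ L N K .{{_ : NonZero K}} s l → L ℤ.* + K ≡ N ℤ.* (s ℤ.^ l) → ι L ≡ (N ℚ./ K) ℚ.* (ι s ^ℚ l)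
ι≡/*^ℚ L N (suc K) s l L*K≡N*s^l = ℚP.toℚᵘ-injective (begin
  ℚ.toℚᵘ (ι L)                                       ≈⟨ ℚP.toℚᵘ-fromℚᵘ (mkℚᵘ L 0) ⟩
  mkℚᵘ L 0                                           ≈⟨ ℚᵘ.*≡* cross-multiplied ⟩
  mkℚᵘ N K ℚᵘ.* mkℚᵘ (s ℤ.^ l) 0
    ≈⟨ ℚᵘP.*-cong (ℚP.toℚᵘ-fromℚᵘ (mkℚᵘ N K)) (toℚᵘ-ι^ℚ s l) ⟨
  ℚ.toℚᵘ (N ℚ./ suc K) ℚᵘ.* ℚ.toℚᵘ (ι s ^ℚ l)        ≈⟨ ℚP.toℚᵘ-homo-* (N ℚ./ suc K) (ι s ^ℚ l) ⟨
  ℚ.toℚᵘ ((N ℚ./ suc K) ℚ.* (ι s ^ℚ l))              ∎)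
  where
  open ℚᵘP.≃-Reasoning
  cross-multiplied : L ℤ.* + (suc K * 1) ≡ (N ℤ.* (s ℤ.^ l)) ℤ.* + 1
  cross-multiplied = trans (cong (λ k → L ℤ.* + k) (*-identityʳ (suc K)))
                           (trans L*K≡N*s^l (sym (ℤP.*-identityʳ _)))

2∣n*[1+n] : ∀ n → 2 ∣ n * suc n
2∣n*[1+n] zero = _ ∣0
2∣n*[1+n] (suc n) = subst (2 ∣_) (step n) (∣m∣n⇒∣m+n (2∣n*[1+n] n) (n∣m*n (suc n)))
  where
  step : ∀ n → n * suc n + suc n * 2 ≡ suc n * suc (suc n)
  step = solve-∀

4*Qpoly≡Lpoly²+d²∸1 : ∀ d x .{{_ : NonZero d}} →
                      + 4 ℤ.* Qpoly d x ≡ Lpoly d x ℤ.* Lpoly d x ℤ.+ + (d * d ∸ 1)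
4*Qpoly≡Lpoly²+d²∸1 d x = begin
  + 4 ℤ.* (x ℤ.* x ℤ.+ + suc d ℤ.* x ℤ.+ + h)            ≡⟨ split-constant x (+ d) (+ h) ⟩
  + 4 ℤ.* (x ℤ.* x ℤ.+ + suc d ℤ.* x) ℤ.+ + h ℤ.* + 2 ℤ.* + 2
    ≡⟨ cong (λ c → + 4 ℤ.* (x ℤ.* x ℤ.+ + suc d ℤ.* x) ℤ.+ c ℤ.* + 2) 2h≡d[d+1] ⟩
  + 4 ℤ.* (x ℤ.* x ℤ.+ + suc d ℤ.* x) ℤ.+ + d ℤ.* + suc d ℤ.* + 2 ≡⟨ complete-square x (+ d) ⟩
  Lpoly d x ℤ.* Lpoly d x ℤ.+ (+ d ℤ.* + d ℤ.- + 1)       ≡⟨ cong (ℤ._+_ (Lpoly d x ℤ.* Lpoly d x)) d²-1≡ ⟩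
  Lpoly d x ℤ.* Lpoly d x ℤ.+ + (d * d ∸ 1)               ∎
  where
  open ≡-Reasoning
  -- h is a truncated ℕ-division; 2 ∣ d(d+1) turns it into a ring expression for the solver.
  h = d * suc d / 2
  2h≡d[d+1] : + h ℤ.* + 2 ≡ + d ℤ.* + suc d
  2h≡d[d+1] = trans (sym (ℤP.pos-* h 2)) (trans (cong +_ (m/n*n≡m (2∣n*[1+n] d))) (ℤP.pos-* d (suc d)))
  d²-1≡ : + d ℤ.* + d ℤ.- + 1 ≡ + (d * d ∸ 1)
  d²-1≡ = trans (cong (ℤ._- + 1) (sym (ℤP.pos-* d d)))
                (trans (ℤP.m-n≡m⊖n (d * d) 1) (ℤP.⊖-≥ (*-mono-≤ (>-nonZero⁻¹ d) (>-nonZero⁻¹ d))))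
  split-constant : ∀ x D H → + 4 ℤ.* (x ℤ.* x ℤ.+ (+ 1 ℤ.+ D) ℤ.* x ℤ.+ H) ≡
                             + 4 ℤ.* (x ℤ.* x ℤ.+ (+ 1 ℤ.+ D) ℤ.* x) ℤ.+ H ℤ.* + 2 ℤ.* + 2
  split-constant = ℤSolver.solve-∀
  complete-square : ∀ x D → + 4 ℤ.* (x ℤ.* x ℤ.+ (+ 1 ℤ.+ D) ℤ.* x) ℤ.+ D ℤ.* (+ 1 ℤ.+ D) ℤ.* + 2 ≡
                            (+ 2 ℤ.* x ℤ.+ D ℤ.+ + 1) ℤ.* (+ 2 ℤ.* x ℤ.+ D ℤ.+ + 1) ℤ.+ (D ℤ.* D ℤ.- + 1)
  complete-square = ℤSolver.solve-∀

module _ (d : ℕ) .{{_ : NonZero d}} (x : ℤ) where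
  private
    n = ℤ.∣ Lpoly d x ∣
    4Q≡n²+d²∸1 : + 4 ℤ.* Qpoly d x ≡ + (n * n + (d * d ∸ 1))
    4Q≡n²+d²∸1 = trans (4*Qpoly≡Lpoly²+d²∸1 d x)
                       (trans (cong (ℤ._+ + (d * d ∸ 1)) (i*i≡∣i∣*∣i∣ (Lpoly d x))) (sym (ℤP.pos-+ (n * n) _)))

  Qpoly≥0 : Qpoly d x ≡ + ℤ.∣ Qpoly d x ∣
  Qpoly≥0 = 4i≡+k⇒i≡+∣i∣ 4Q≡n²+d²∸1

  4∣Qpoly∣≡∣Lpoly∣²+d²∸1 : 4 * ℤ.∣ Qpoly d x ∣ ≡ n * n + (d * d ∸ 1)
  4∣Qpoly∣≡∣Lpoly∣²+d²∸1 =
    ℤP.+-injective (trans (ℤP.pos-* 4 ℤ.∣ Qpoly d x ∣) (trans (cong (+ 4 ℤ.*_) (sym Qpoly≥0)) 4Q≡n²+d²∸1))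

d*d∸1≢0 : ∀ d .{{_ : NonTrivial d}} → NonZero (d * d ∸ 1)
d*d∸1≢0 (2+ _) = _

∣Qpoly∣≢0 : ∀ d .{{_ : NonTrivial d}} x → NonZero ℤ.∣ Qpoly d x ∣
∣Qpoly∣≢0 d x = m*n≢0⇒n≢0 4 {{subst NonZero (sym (4∣Qpoly∣≡∣Lpoly∣²+d²∸1 d x)) (≢-nonZero n²+D≢0)}}
  where
  instance
    _ = nonTrivial⇒nonZero d
    _ = d*d∸1≢0 d
  n = ℤ.∣ Lpoly d x ∣
  n²+D≢0 : n * n + (d * d ∸ 1) ≢ 0
  n²+D≢0 n²+D≡0 = ≢-nonZero⁻¹ (d * d ∸ 1) (m+n≡0⇒n≡0 (n * n) n²+D≡0)

d∣L∣∣Q∣≡2∣y∣^ℓ : ∀ d L Q y ℓ → + d ℤ.* L ℤ.* Q ≡ + 2 ℤ.* (y ℤ.^ ℓ) →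
                 d * ℤ.∣ L ∣ * ℤ.∣ Q ∣ ≡ 2 * ℤ.∣ y ∣ ^ ℓ
d∣L∣∣Q∣≡2∣y∣^ℓ d L Q y ℓ eq = begin
  d * ℤ.∣ L ∣ * ℤ.∣ Q ∣          ≡⟨ cong (_* ℤ.∣ Q ∣) (ℤP.abs-* (+ d) L) ⟨
  ℤ.∣ + d ℤ.* L ∣ * ℤ.∣ Q ∣      ≡⟨ ℤP.abs-* (+ d ℤ.* L) Q ⟨
  ℤ.∣ + d ℤ.* L ℤ.* Q ∣          ≡⟨ cong ℤ.∣_∣ eq ⟩
  ℤ.∣ + 2 ℤ.* (y ℤ.^ ℓ) ∣        ≡⟨ ℤP.abs-* (+ 2) (y ℤ.^ ℓ) ⟩
  2 * ℤ.∣ y ℤ.^ ℓ ∣              ≡⟨ cong (2 *_) (abs-^ y ℓ) ⟩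
  2 * ℤ.∣ y ∣ ^ ℓ                ∎
  where open ≡-Reasoning

q∣d⇒q∤d²∸1 : ∀ {q d} .{{_ : NonTrivial q}} .{{_ : NonZero d}} → q ∣ d → ¬ q ∣ d * d ∸ 1
q∣d⇒q∤d²∸1 {q} {d} q∣d q∣d²∸1 = nonTrivial⇒≢1 (∣1⇒≡1 (∣m+n∣m⇒∣n q∣d² q∣d²∸1))
  where
  q∣d² : q ∣ d * d ∸ 1 + 1
  q∣d² = subst (q ∣_) (sym (m∸n+n≡m (*-mono-≤ (>-nonZero⁻¹ d) (>-nonZero⁻¹ d)))) (∣n⇒∣m*n d q∣d)

-- The sets T_q

-- The exponent pairs (ord_q α , ord_q β) when 2a < m, 2a = m, 2a > m, where t, v, m, a are the
-- q-adic valuations of 2, d, d²−1, 2x+d+1.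
data Shape (t v m : ℕ) : ℤ × ℤ → Set where
  below : 0 < m → Shape t v m (+ t , + 0)
  at    : ∀ a → a + a ≡ m → Shape t v m (+ a , + t ℤ.- + (v + a))
  above : 2 * t ≤ m → Shape t v m (+ (3 * t) ℤ.- + (v + m) , + m ℤ.- + (2 * t))

private
  a+a≡a*2 : ∀ a → a + a ≡ a * 2
  a+a≡a*2 = solve-∀

a+a≡m⇒m/2≡a : ∀ {a m} → a + a ≡ m → m / 2 ≡ a
a+a≡m⇒m/2≡a {a} refl = trans (cong (_/ 2) (a+a≡a*2 a)) (m*n/n≡m a 2)

a+a≡m⇒m%2≡0 : ∀ {a m} → a + a ≡ m → m % 2 ≡ 0
a+a≡m⇒m%2≡0 {a} refl = trans (cong (_% 2) (a+a≡a*2 a)) (m*n%n≡0 a 2)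

module _ where
  private variable
    v m : ℕ
    p : ℤ × ℤ

  private
    -+m,+m : (+ 0 ℤ.- + m , + m ℤ.- + 0) ≡ (ℤ.- + m , + m)
    -+m,+m = cong₂ _,_ (ℤP.+-identityˡ _) (ℤP.+-identityʳ _)

    0-[v+0]≡-v : ∀ v → + 0 ℤ.- + (v + 0) ≡ ℤ.- + v
    0-[v+0]≡-v v = trans (ℤP.+-identityˡ _) (cong (λ v → ℤ.- + v) (+-identityʳ v))

  ∈T-2∣d : Shape 1 v 0 p → p ∈ (+ 0 , + 1 ℤ.- + v) ∷ []
  ∈T-2∣d {v = v} (at a a+a≡0) with m+n≡0⇒m≡0 a a+a≡0
  ... | refl = here (cong (λ v → + 0 , + 1 ℤ.- + v) (+-identityʳ v))
  ∈T-2∣d (above ())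

  ∈T-2∤d-μ-even : Shape 1 0 m p → p ∈ (+ 1 , + 0) ∷ (+ (m / 2) , + 1 ℤ.- + (m / 2)) ∷ (+ 3 ℤ.- + m , + m ℤ.- + 2) ∷ []
  ∈T-2∤d-μ-even (below _) = here refl
  ∈T-2∤d-μ-even (at a a+a≡m) = there (here (cong (λ h → + h , + 1 ℤ.- + h) (sym (a+a≡m⇒m/2≡a {a} a+a≡m))))
  ∈T-2∤d-μ-even (above _) = there (there (here refl))

  ∈T-2∤d-μ-odd : m % 2 ≢ 0 → Shape 1 0 m p → p ∈ (+ 1 , + 0) ∷ (+ 3 ℤ.- + m , + m ℤ.- + 2) ∷ []
  ∈T-2∤d-μ-odd _ (below _) = here refl
  ∈T-2∤d-μ-odd m-odd (at a a+a≡m) = contradiction (a+a≡m⇒m%2≡0 {a} a+a≡m) m-odd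
  ∈T-2∤d-μ-odd _ (above _) = there (here refl)

  ∈T-q∣d : Shape 0 v 0 p → p ∈ (ℤ.- + v , + 0) ∷ (+ 0 , ℤ.- + v) ∷ []
  ∈T-q∣d {v = v} (at a a+a≡0) with m+n≡0⇒m≡0 a a+a≡0
  ... | refl = there (here (cong (+ 0 ,_) (0-[v+0]≡-v v)))
  ∈T-q∣d {v = v} (above _) = here (cong (_, + 0) (0-[v+0]≡-v v))

  ∈T-q∤dD : Shape 0 0 0 p → p ∈ (+ 0 , + 0) ∷ []
  ∈T-q∤dD (at a a+a≡0) with m+n≡0⇒m≡0 a a+a≡0
  ... | refl = here refl
  ∈T-q∤dD (above _) = here refl

  ∈T-q∣D-μ-even : Shape 0 0 m p → p ∈ (+ 0 , + 0) ∷ (ℤ.- + m , + m) ∷ (+ (m / 2) , ℤ.- + (m / 2)) ∷ []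
  ∈T-q∣D-μ-even (below _) = here refl
  ∈T-q∣D-μ-even (at a a+a≡m) = there (there (here (trans (cong (+ a ,_) (ℤP.+-identityˡ _))
                                                         (cong (λ h → + h , ℤ.- + h) (sym (a+a≡m⇒m/2≡a {a} a+a≡m))))))
  ∈T-q∣D-μ-even (above _) = there (here -+m,+m)

  ∈T-q∣D-μ-odd : m % 2 ≢ 0 → Shape 0 0 m p → p ∈ (+ 0 , + 0) ∷ (ℤ.- + m , + m) ∷ []
  ∈T-q∣D-μ-odd _ (below _) = here refl
  ∈T-q∣D-μ-odd m-odd (at a a+a≡m) = contradiction (a+a≡m⇒m%2≡0 {a} a+a≡m) m-odd
  ∈T-q∣D-μ-odd _ (above _) = there (here -+m,+m)

Shape-subst : ∀ {t v v′ m m′ p} → v ≡ v′ → m ≡ m′ → Shape t v m p → Shape t v′ m′ p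
Shape-subst refl refl s = s

Shape-subst-t : ∀ {t t′ v m p} → t ≡ t′ → Shape t v m p → Shape t′ v m p
Shape-subst-t refl s = s

shape⇒∈T : ∀ {d q p} .{{_ : NonZero d}} → Prime q →
           Shape (ordℕ q 2) (ordℕ q d) (ordℕ q (d * d ∸ 1)) p → p ∈ T d q
shape⇒∈T {d} {q} {p} q-prime = by-q (q ≟ 2)
  where
  instance _ = prime⇒nonTrivial q-prime
  by-q : Dec (q ≡ 2) → Shape (ordℕ q 2) (ordℕ q d) (ordℕ q (d * d ∸ 1)) p → p ∈ T d q
  by-q (yes refl) shape with 2 ∣? d
  ... | yes 2∣d = ∈T-2∣d (Shape-subst refl (ordℕ-∤ (q∣d⇒q∤d²∸1 2∣d)) shape)
  ... | no 2∤d with μeven? d 2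
  ...   | yes _ = ∈T-2∤d-μ-even (Shape-subst (ordℕ-∤ 2∤d) refl shape)
  ...   | no m-odd = ∈T-2∤d-μ-odd m-odd (Shape-subst (ordℕ-∤ 2∤d) refl shape)
  -- T d q only unfolds once the test q ≟ 2 from its definition is matched on, hence the repeated test.
  by-q (no q≢2) shape′ with q ≟ 2 | Shape-subst-t (ordℕ-prime prime[2] q≢2) shape′
  ... | yes q≡2 | _ = contradiction q≡2 q≢2
  ... | no _ | shape with q ∣? d
  ...   | yes q∣d = ∈T-q∣d (Shape-subst refl (ordℕ-∤ (q∣d⇒q∤d²∸1 q∣d)) shape)
  ...   | no q∤d with q ∣? (d * d ∸ 1)
  ...     | no q∤D = ∈T-q∤dD (Shape-subst (ordℕ-∤ q∤d) (ordℕ-∤ q∤D) shape)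
  ...     | yes _ with μeven? d q
  ...       | yes _ = ∈T-q∣D-μ-even (Shape-subst (ordℕ-∤ q∤d) refl shape)
  ...       | no m-odd = ∈T-q∣D-μ-odd m-odd (Shape-subst (ordℕ-∤ q∤d) refl shape)

-- Choosing the exponents

-- The exponent of q in y₁, with t, a, m as for Shape and e = ord_q y.
exponentChoice : (ℓ t a m e : ℕ) .{{_ : NonZero ℓ}} → ℕ
exponentChoice ℓ t a m e with <-cmp (a + a) m
... | tri< _ _ _ = (a ∸ t) / ℓ
... | tri≈ _ _ _ = 0
... | tri> _ _ _ = e

ExponentSplit : (ℓ t v m a b e f : ℕ) → Set
ExponentSplit ℓ t v m a b e f = f ≤ e × Shape t v m (+ a ℤ.- + (ℓ * f) , + b ℤ.- + (ℓ * (e ∸ f)))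

module _ {ℓ} (ℓ-prime : Prime ℓ) (ℓ∤3 : ¬ ℓ ∣ 3) where
  private instance
    ℓ≢0 : NonZero ℓ
    ℓ≢0 = prime⇒nonZero ℓ-prime

  below-exponents : ∀ {t a b e} → 2 * t + b ≡ a + a → a + b ≡ t + ℓ * e →
                    ∃[ c ] a ≡ t + c * ℓ × b ≡ c * ℓ + c * ℓ × e ≡ 3 * c
  below-exponents {t} {a} {b} {e} 2t+b≡a+a a+b≡t+ℓe = c , a≡t+cℓ , b≡cℓ+cℓ , e≡3c
    where
    open ≡-Reasoning
    a′ = a ∸ t
    t≤a : t ≤ a
    t≤a = *-cancelˡ-≤ 2 (subst (2 * t ≤_) (trans 2t+b≡a+a (double a)) (m≤m+n (2 * t) b))
      where
      double : ∀ a → a + a ≡ 2 * a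
      double = solve-∀
    a≡t+a′ : a ≡ t + a′
    a≡t+a′ = sym (m+[n∸m]≡n t≤a)
    b≡a′+a′ : b ≡ a′ + a′
    b≡a′+a′ = +-cancelˡ-≡ (2 * t) b (a′ + a′) (begin
      2 * t + b                  ≡⟨ 2t+b≡a+a ⟩
      a + a                      ≡⟨ cong (λ a → a + a) a≡t+a′ ⟩
      (t + a′) + (t + a′)        ≡⟨ interchange t a′ ⟩
      2 * t + (a′ + a′)          ∎)
      where
      interchange : ∀ t a → (t + a) + (t + a) ≡ 2 * t + (a + a)
      interchange = solve-∀
    ℓ*e≡3*a′ : ℓ * e ≡ 3 * a′
    ℓ*e≡3*a′ = +-cancelˡ-≡ t (ℓ * e) (3 * a′) (begin
      t + ℓ * e                  ≡⟨ a+b≡t+ℓe ⟨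
      a + b                      ≡⟨ cong₂ _+_ a≡t+a′ b≡a′+a′ ⟩
      t + a′ + (a′ + a′)         ≡⟨ collect t a′ ⟩
      t + 3 * a′                 ∎)
      where
      collect : ∀ t a → t + a + (a + a) ≡ t + 3 * a
      collect = solve-∀
    ℓ∣a′ : ℓ ∣ a′
    ℓ∣a′ = [ flip contradiction ℓ∤3 , id ]′ (euclidsLemma 3 a′ ℓ-prime (divides e (trans (sym ℓ*e≡3*a′) (*-comm ℓ e))))
    c = quotient ℓ∣a′
    a′≡cℓ : a′ ≡ c * ℓ
    a′≡cℓ = _∣_.equality ℓ∣a′
    a≡t+cℓ = trans a≡t+a′ (cong (_+_ t) a′≡cℓ)
    b≡cℓ+cℓ = trans b≡a′+a′ (cong (λ a → a + a) a′≡cℓ)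
    e≡3c : e ≡ 3 * c
    e≡3c = *-cancelˡ-≡ e (3 * c) ℓ (trans ℓ*e≡3*a′ (trans (cong (3 *_) a′≡cℓ) (swap c ℓ)))
      where
      swap : ∀ c ℓ → 3 * (c * ℓ) ≡ ℓ * (3 * c)
      swap = solve-∀

  module _ {t v m a b e : ℕ} (ord-eq : v + a + b ≡ t + ℓ * e) where

    below-split : a + a < m → 2 * t + b ≡ a + a → v ≡ 0 → ExponentSplit ℓ t v m a b e ((a ∸ t) / ℓ)
    below-split a+a<m 2t+b≡a+a v≡0 =
      subst (ExponentSplit ℓ t v m a b e) (sym f≡c) (c≤e , subst (Shape t v m) pair≡ (below (≤-trans (s≤s z≤n) a+a<m)))
      where
      exps = below-exponents 2t+b≡a+a (subst (λ v → v + a + b ≡ t + ℓ * e) v≡0 ord-eq)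
      c = proj₁ exps
      a≡t+cℓ = proj₁ (proj₂ exps)
      b≡cℓ+cℓ = proj₁ (proj₂ (proj₂ exps))
      e≡3c = proj₂ (proj₂ (proj₂ exps))
      f≡c : (a ∸ t) / ℓ ≡ c
      f≡c = trans (cong (λ a → (a ∸ t) / ℓ) a≡t+cℓ) (trans (cong (_/ ℓ) (m+n∸m≡n t (c * ℓ))) (m*n/n≡m c ℓ))
      c≤e : c ≤ e
      c≤e = subst (c ≤_) (sym e≡3c) (m≤n*m c 3)
      pair≡ : (+ t , + 0) ≡ (+ a ℤ.- + (ℓ * c) , + b ℤ.- + (ℓ * (e ∸ c)))
      pair≡ = sym (cong₂ _,_ (+a-+b≡+c a (ℓ * c) t (trans a≡t+cℓ (cong (_+_ t) (*-comm c ℓ))))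
                            (+a-+b≡+c b (ℓ * (e ∸ c)) 0 (trans b≡cℓ+cℓ (trans (double c ℓ)
                              (cong (ℓ *_) (sym (trans (cong (_∸ c) e≡3c) (m+n∸m≡n c (2 * c)))))))))
        where
        double : ∀ c ℓ → c * ℓ + c * ℓ ≡ ℓ * (2 * c)
        double = solve-∀

    at-split : a + a ≡ m → ExponentSplit ℓ t v m a b e 0
    at-split a+a≡m = z≤n , subst (Shape t v m) pair≡ (at a a+a≡m)
      where
      pair≡ : (+ a , + t ℤ.- + (v + a)) ≡ (+ a ℤ.- + (ℓ * 0) , + b ℤ.- + (ℓ * e))
      pair≡ = sym (cong₂ _,_ (+a-+b≡+c a (ℓ * 0) a (trans (sym (+-identityʳ a)) (cong (_+_ a) (sym (*-zeroʳ ℓ)))))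
                            (+a-+b≡+c-+d b (ℓ * e) t (v + a) (trans (rearrange v a b) ord-eq)))
        where
        rearrange : ∀ v a b → b + (v + a) ≡ v + a + b
        rearrange = solve-∀

    above-split : 2 * t + b ≡ m → ExponentSplit ℓ t v m a b e e
    above-split 2t+b≡m = ≤-refl , subst (Shape t v m) pair≡ (above (subst (2 * t ≤_) 2t+b≡m (m≤m+n (2 * t) b)))
      where
      open ≡-Reasoning
      first : a + (v + m) ≡ 3 * t + ℓ * e
      first = begin
        a + (v + m)              ≡⟨ cong (λ m → a + (v + m)) (sym 2t+b≡m) ⟩
        a + (v + (2 * t + b))    ≡⟨ rearrange t v a b ⟩
        v + a + b + 2 * t        ≡⟨ cong (_+ 2 * t) ord-eq ⟩
        t + ℓ * e + 2 * t        ≡⟨ collect t (ℓ * e) ⟩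
        3 * t + ℓ * e            ∎
        where
        rearrange : ∀ t v a b → a + (v + (2 * t + b)) ≡ v + a + b + 2 * t
        rearrange = solve-∀
        collect : ∀ t x → t + x + 2 * t ≡ 3 * t + x
        collect = solve-∀
      second : b + 2 * t ≡ m + ℓ * (e ∸ e)
      second = begin
        b + 2 * t          ≡⟨ trans (+-comm b (2 * t)) 2t+b≡m ⟩
        m                  ≡⟨ +-identityʳ m ⟨
        m + 0              ≡⟨ cong (_+_ m) (trans (sym (*-zeroʳ ℓ)) (cong (ℓ *_) (sym (n∸n≡0 e)))) ⟩
        m + ℓ * (e ∸ e)    ∎
      pair≡ : (+ (3 * t) ℤ.- + (v + m) , + m ℤ.- + (2 * t)) ≡ (+ a ℤ.- + (ℓ * e) , + b ℤ.- + (ℓ * (e ∸ e)))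
      pair≡ = sym (cong₂ _,_ (+a-+b≡+c-+d a (ℓ * e) (3 * t) (v + m) first)
                            (+a-+b≡+c-+d b (ℓ * (e ∸ e)) m (2 * t) second))

  exponentChoice-splits : ∀ {t v m a b e} → v + a + b ≡ t + ℓ * e →
    (a + a < m → 2 * t + b ≡ a + a) → (m < a + a → 2 * t + b ≡ m) → (0 < m → v ≡ 0) →
    ExponentSplit ℓ t v m a b e (exponentChoice ℓ t a m e)
  exponentChoice-splits {t} {v} {m} {a} ord-eq ord-below ord-above v≡0 with <-cmp (a + a) m
  ... | tri< a+a<m _ _ = below-split ord-eq a+a<m (ord-below a+a<m) (v≡0 (≤-trans (s≤s z≤n) a+a<m))
  ... | tri≈ _ a+a≡m _ = at-split ord-eq a+a≡m
  ... | tri> _ _ m<a+a = above-split ord-eq (ord-above m<a+a)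

ordℕ-4* : ∀ {q} → Prime q → ∀ Q .{{_ : NonZero Q}} → ordℕ q (4 * Q) ≡ 2 * ordℕ q 2 + ordℕ q Q
ordℕ-4* {q} q-prime Q = trans (ordℕ-* q-prime 4 Q) (cong (_+ ordℕ q Q) (ordℕ-^ q-prime 2 2))

IntegralDecomposition : ℕ → ℕ → ℤ → ℤ → Set
IntegralDecomposition d ℓ L Q = Σ ℤ λ y₁ → Σ ℤ λ y₂ → Σ ℚ λ α → Σ ℚ λ β →
  InA d α β × ι L ≡ α ℚ.* (ι y₁ ^ℚ ℓ) × ι Q ≡ β ℚ.* (ι y₂ ^ℚ ℓ)

module _ {d ℓ : ℕ} .{{_ : NonTrivial d}} (ℓ-prime : Prime ℓ) where
  private instance
    d≢0 : NonZero d
    d≢0 = nonTrivial⇒nonZero d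
    d²∸1≢0 : NonZero (d * d ∸ 1)
    d²∸1≢0 = d*d∸1≢0 d
    d[d²∸1]≢0 : NonZero (d * (d * d ∸ 1))
    d[d²∸1]≢0 = m*n≢0 d (d * d ∸ 1)
    ℓ≢0 : NonZero ℓ
    ℓ≢0 = prime⇒nonZero ℓ-prime

  decomposition-L≡0 : ∀ {L Q} .{{_ : NonZero ℤ.∣ Q ∣}} → L ≡ + 0 → Q ≡ + ℤ.∣ Q ∣ →
                      4 * ℤ.∣ Q ∣ ≡ d * d ∸ 1 → IntegralDecomposition d ℓ L Q
  decomposition-L≡0 {Q = Q} refl Q≥0 4Q≡d²∸1 =
    + 0 , + 1 , α , β , (ℚP.normalize-pos 8 (d * (d * d ∸ 1)) , ℚP.normalize-pos ℤ.∣ Q ∣ 1 , α,β∈T) ,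
    ι≡/*^ℚ (+ 0) (+ 8) (d * (d * d ∸ 1)) (+ 0) ℓ (sym (8*0^ℓ≡0 ℓ)) ,
    subst (λ Q → ι Q ≡ β ℚ.* (ι (+ 1) ^ℚ ℓ)) (sym Q≥0)
          (ι≡/*^ℚ (+ ℤ.∣ Q ∣) (+ ℤ.∣ Q ∣) 1 (+ 1) ℓ (cong (+ ℤ.∣ Q ∣ ℤ.*_) (sym (ℤP.^-zeroˡ ℓ))))
    where
    α = + 8 ℚ./ (d * (d * d ∸ 1))
    β = + ℤ.∣ Q ∣ ℚ./ 1
    8*0^ℓ≡0 : ∀ ℓ .{{_ : NonZero ℓ}} → + 8 ℤ.* (+ 0) ℤ.^ ℓ ≡ + 0
    8*0^ℓ≡0 (suc ℓ) = refl
    α,β∈T : (q : ℕ) → Prime q → (ordℚ q α , ordℚ q β) ∈ T d q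
    α,β∈T q q-prime = shape⇒∈T q-prime (subst (Shape t v m) pair≡ (above 2t≤m))
      where
      instance _ = prime⇒nonTrivial q-prime
      t = ordℕ q 2
      v = ordℕ q d
      m = ordℕ q (d * d ∸ 1)
      b = ordℕ q ℤ.∣ Q ∣
      2t+b≡m : 2 * t + b ≡ m
      2t+b≡m = trans (sym (ordℕ-4* q-prime ℤ.∣ Q ∣)) (cong (ordℕ q) 4Q≡d²∸1)
      2t≤m : 2 * t ≤ m
      2t≤m = subst (2 * t ≤_) 2t+b≡m (m≤m+n (2 * t) b)
      pair≡ : (+ (3 * t) ℤ.- + (v + m) , + m ℤ.- + (2 * t)) ≡ (ordℚ q α , ordℚ q β)
      pair≡ = sym (cong₂ _,_
        (trans (ordℚ-normalize q-prime 8 (d * (d * d ∸ 1)))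
               (cong₂ (λ a b → + a ℤ.- + b) (ordℕ-^ q-prime 2 3) (ordℕ-* q-prime d (d * d ∸ 1))))
        (trans (ordℚ-normalize q-prime ℤ.∣ Q ∣ 1)
               (trans (cong (λ o → + b ℤ.- + o) ordℕ-1)
                      (+a-+b≡+c-+d b 0 m (2 * t) (trans (+-comm b (2 * t)) (trans 2t+b≡m (sym (+-identityʳ m))))))))

  module _ (ℓ∤3 : ¬ ℓ ∣ 3) {n Q Y : ℕ} .{{_ : NonZero n}} .{{_ : NonZero Q}} .{{_ : NonZero Y}}
           (dnQ≡2Y^ℓ : d * n * Q ≡ 2 * Y ^ ℓ) (4Q≡n²+d²∸1 : 4 * Q ≡ n * n + (d * d ∸ 1)) where

    y₁-exponent : ℕ → ℕ
    y₁-exponent q = exponentChoice ℓ (ordℕ q 2) (ordℕ q n) (ordℕ q (d * d ∸ 1)) (ordℕ q Y)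

    valuations-split : ∀ {q} → Prime q →
      ExponentSplit ℓ (ordℕ q 2) (ordℕ q d) (ordℕ q (d * d ∸ 1)) (ordℕ q n) (ordℕ q Q) (ordℕ q Y)
                    (y₁-exponent q)
    valuations-split {q} q-prime = exponentChoice-splits ℓ-prime ℓ∤3 ord-eq ord-below ord-above v≡0
      where
      instance
        _ = prime⇒nonTrivial q-prime
        n²≢0 : NonZero (n * n)
        n²≢0 = m*n≢0 n n
      open ≡-Reasoning
      D = d * d ∸ 1
      t = ordℕ q 2
      v = ordℕ q d
      a = ordℕ q n
      b = ordℕ q Q
      m = ordℕ q D
      ord-n² : ordℕ q (n * n) ≡ a + a
      ord-n² = ordℕ-* q-prime n n
      ord-eq : v + a + b ≡ t + ℓ * ordℕ q Y
      ord-eq = begin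
        v + a + b                  ≡⟨ cong (_+ b) (ordℕ-* q-prime d n) ⟨
        ordℕ q (d * n) + b         ≡⟨ ordℕ-* q-prime (d * n) Q {{m*n≢0 d n}} ⟨
        ordℕ q (d * n * Q)         ≡⟨ cong (ordℕ q) dnQ≡2Y^ℓ ⟩
        ordℕ q (2 * Y ^ ℓ)         ≡⟨ ordℕ-* q-prime 2 (Y ^ ℓ) {{_}} {{m^n≢0 Y ℓ}} ⟩
        t + ordℕ q (Y ^ ℓ)         ≡⟨ cong (_+_ t) (ordℕ-^ q-prime Y ℓ) ⟩
        t + ℓ * ordℕ q Y           ∎
      2t+b≡ord[n²+D] : 2 * t + b ≡ ordℕ q (n * n + D)
      2t+b≡ord[n²+D] = trans (sym (ordℕ-4* q-prime Q)) (cong (ordℕ q) 4Q≡n²+d²∸1)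
      ord-below : a + a < m → 2 * t + b ≡ a + a
      ord-below 2a<m = begin
        2 * t + b                  ≡⟨ 2t+b≡ord[n²+D] ⟩
        ordℕ q (n * n + D)         ≡⟨ ordℕ-+ (n * n) D (subst (_< m) (sym ord-n²) 2a<m) ⟩
        ordℕ q (n * n)             ≡⟨ ord-n² ⟩
        a + a                      ∎
      ord-above : m < a + a → 2 * t + b ≡ m
      ord-above m<2a = begin
        2 * t + b                  ≡⟨ 2t+b≡ord[n²+D] ⟩
        ordℕ q (n * n + D)         ≡⟨ cong (ordℕ q) (+-comm (n * n) D) ⟩
        ordℕ q (D + n * n)         ≡⟨ ordℕ-+ D (n * n) (subst (m <_) (sym ord-n²) m<2a) ⟩
        m                          ∎
      v≡0 : 0 < m → v ≡ 0
      v≡0 0<m = ordℕ-∤ λ q∣d → q∣d⇒q∤d²∸1 q∣d (ordℕ≢0⇒∣ (≢-nonZero⁻¹ _ {{>-nonZero 0<m}}))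

    decomposition-L≢0 : ¬ 2 ∣ ℓ → ∀ L → ℤ.∣ L ∣ ≡ n → IntegralDecomposition d ℓ L (+ Q)
    decomposition-L≢0 ℓ-odd L refl =
      sign L ◃ U₁ , + U₂ , α , β , (ℚP.normalize-pos n (U₁ ^ ℓ) , ℚP.normalize-pos Q (U₂ ^ ℓ) , α,β∈T) ,
      ι≡/*^ℚ L (+ n) (U₁ ^ ℓ) (sign L ◃ U₁) ℓ (i*u^ℓ≡∣i∣*[sign◃u]^ℓ ℓ-odd L U₁) ,
      ι≡/*^ℚ (+ Q) (+ Q) (U₂ ^ ℓ) (+ U₂) ℓ (cong (+ Q ℤ.*_) (sym (pos-^ U₂ ℓ)))
      where
      U₁-spec = ∃-ordℕ≡ Y y₁-exponent (λ q-prime → proj₁ (valuations-split q-prime))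
      U₂-spec = ∃-ordℕ≡ Y (λ q → ordℕ q Y ∸ y₁-exponent q) (λ {q} _ → m∸n≤m (ordℕ q Y) (y₁-exponent q))
      U₁ = proj₁ U₁-spec
      U₂ = proj₁ U₂-spec
      instance
        U₁^ℓ≢0 : NonZero (U₁ ^ ℓ)
        U₁^ℓ≢0 = m^n≢0 U₁ ℓ {{proj₁ (proj₂ U₁-spec)}}
        U₂^ℓ≢0 : NonZero (U₂ ^ ℓ)
        U₂^ℓ≢0 = m^n≢0 U₂ ℓ {{proj₁ (proj₂ U₂-spec)}}
      α = + n ℚ./ (U₁ ^ ℓ)
      β = + Q ℚ./ (U₂ ^ ℓ)
      α,β∈T : (q : ℕ) → Prime q → (ordℚ q α , ordℚ q β) ∈ T d q
      α,β∈T q q-prime = shape⇒∈T q-prime (subst (Shape _ _ _) pair≡ (proj₂ (valuations-split q-prime)))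
        where
        ordℕ-U^ℓ : ∀ {U} .{{_ : NonZero U}} {g} → ordℕ q U ≡ g → ordℕ q (U ^ ℓ) ≡ ℓ * g
        ordℕ-U^ℓ {U} ord≡ = trans (ordℕ-^ q-prime U ℓ) (cong (ℓ *_) ord≡)
        pair≡ : (+ ordℕ q n ℤ.- + (ℓ * y₁-exponent q) , + ordℕ q Q ℤ.- + (ℓ * (ordℕ q Y ∸ y₁-exponent q)))
              ≡ (ordℚ q α , ordℚ q β)
        pair≡ = sym (cong₂ _,_
          (trans (ordℚ-normalize q-prime n (U₁ ^ ℓ)) (cong (λ o → + ordℕ q n ℤ.- + o)
                 (ordℕ-U^ℓ {{proj₁ (proj₂ U₁-spec)}} (proj₂ (proj₂ U₁-spec) q-prime))))
          (trans (ordℚ-normalize q-prime Q (U₂ ^ ℓ)) (cong (λ o → + ordℕ q Q ℤ.- + o)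
                 (ordℕ-U^ℓ {{proj₁ (proj₂ U₂-spec)}} (proj₂ (proj₂ U₂-spec) q-prime)))))

m^n≢0⇒m≢0 : ∀ m n .{{_ : NonZero n}} .{{_ : NonZero (m ^ n)}} → NonZero m
m^n≢0⇒m≢0 zero (suc n) = contradiction refl (≢-nonZero⁻¹ (0 ^ suc n))
m^n≢0⇒m≢0 (suc m) n = _

decomposition : ∀ d ℓ .{{_ : NonTrivial d}} → Prime ℓ → ¬ ℓ ∣ 3 → ¬ 2 ∣ ℓ → ∀ x y →
                + d ℤ.* Lpoly d x ℤ.* Qpoly d x ≡ + 2 ℤ.* (y ℤ.^ ℓ) →
                IntegralDecomposition d ℓ (Lpoly d x) (Qpoly d x)
decomposition d ℓ ℓ-prime ℓ∤3 ℓ-odd x y eq with ℤ.∣ Lpoly d x ∣ ≟ 0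
... | yes ∣L∣≡0 = decomposition-L≡0 ℓ-prime {{∣Qpoly∣≢0 d x}} (ℤP.∣i∣≡0⇒i≡0 {Lpoly d x} ∣L∣≡0) (Qpoly≥0 d x)
                    (trans (4∣Qpoly∣≡∣Lpoly∣²+d²∸1 d x) (cong (λ n → n * n + (d * d ∸ 1)) ∣L∣≡0))
  where instance _ = nonTrivial⇒nonZero d
... | no ∣L∣≢0 = subst (IntegralDecomposition d ℓ (Lpoly d x)) (sym (Qpoly≥0 d x))
                   (decomposition-L≢0 ℓ-prime ℓ∤3 dnQ≡2Y^ℓ (4∣Qpoly∣≡∣Lpoly∣²+d²∸1 d x) ℓ-odd (Lpoly d x) refl)
  where
  n = ℤ.∣ Lpoly d x ∣
  Q = ℤ.∣ Qpoly d x ∣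
  dnQ≡2Y^ℓ = d∣L∣∣Q∣≡2∣y∣^ℓ d (Lpoly d x) (Qpoly d x) y ℓ eq
  instance
    _ = nonTrivial⇒nonZero d
    n≢0 : NonZero n
    n≢0 = ≢-nonZero ∣L∣≢0
    Q≢0 : NonZero Q
    Q≢0 = ∣Qpoly∣≢0 d x
    Y≢0 : NonZero ℤ.∣ y ∣
    Y≢0 = m^n≢0⇒m≢0 ℤ.∣ y ∣ ℓ {{prime⇒nonZero ℓ-prime}}
            {{m*n≢0⇒n≢0 2 {{subst NonZero dnQ≡2Y^ℓ (m*n≢0 (d * n) Q {{m*n≢0 d n}})}}}}

5≤ℓ⇒ℓ∤3 : ∀ {ℓ} → 5 ≤ ℓ → ¬ ℓ ∣ 3
5≤ℓ⇒ℓ∤3 ℓ≥5 ℓ∣3 = <⇒≱ ℓ≥5 (≤-trans (∣⇒≤ ℓ∣3) (n≤1+n 3))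

5≤prime⇒¬2∣ : ∀ {ℓ} → Prime ℓ → 5 ≤ ℓ → ¬ 2 ∣ ℓ
5≤prime⇒¬2∣ ℓ-prime ℓ≥5 2∣ℓ with prime⇒irreducible ℓ-prime 2∣ℓ
... | inj₁ ()
... | inj₂ refl = contradiction ℓ≥5 λ { (s≤s (s≤s ())) }

lemma4p1 : (d ℓ : ℕ) → 3 ≤ d → Prime ℓ → 5 ≤ ℓ → (x y : ℤ) →
    + d ℤ.* Lpoly d x ℤ.* Qpoly d x ≡ + 2 ℤ.* (y ℤ.^ ℓ) →
    Σ ℚ λ y₁ → Σ ℚ λ y₂ → Σ ℚ λ α → Σ ℚ λ β →
      InA d α β ×
      ι (Lpoly d x) ≡ α Data.Rational.* (y₁ ^ℚ ℓ) ×
      ι (Qpoly d x) ≡ β Data.Rational.* (y₂ ^ℚ ℓ) ×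
      (d ≤ 50 → (∃ λ (m : ℤ) → y₁ ≡ ι m) × (∃ λ (n : ℤ) → y₂ ≡ ι n))
lemma4p1 d ℓ d≥3 ℓ-prime ℓ≥5 x y eq
  with decomposition d ℓ {{n>1⇒nonTrivial (≤-trans (s≤s (s≤s z≤n)) d≥3)}}
         ℓ-prime (5≤ℓ⇒ℓ∤3 ℓ≥5) (5≤prime⇒¬2∣ ℓ-prime ℓ≥5) x y eq
... | y₁ , y₂ , α , β , α,β∈𝒜 , L≡αy₁^ℓ , Q≡βy₂^ℓ =
  ι y₁ , ι y₂ , α , β , α,β∈𝒜 , L≡αy₁^ℓ , Q≡βy₂^ℓ , λ _ → (y₁ , refl) , (y₂ , refl)
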